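{- Let $G$ be a connected $1$-well-covered graph with $|V(G)|=n>2$ and $\alpha(G)=\alpha$, and let $s_k$ denote the number of independent sets of size $k$ in $G$. Then: (i) $2(\alpha-k)\cdot s_k\leq (k+1)\cdot s_{k+1}$ for every $1\leq k<\alpha$; (ii) $s_0\leq s_1\leq\cdots\leq s_{\lceil 2\alpha/3\rceil}$; (iii) $(k+1)\cdot s_{k+1}<(n-2k)\cdot s_k$ for every $1\leq k<\alpha$; (iv) $s_{\lceil \frac{n-1}{3}\rceil}>s_{\lceil \frac{n-1}{3}\rceil+1}>\cdots>s_{\alpha}$.
   Context: All graphs are finite and simple. An independent set is a set of pairwise non-adjacent vertices; $\alpha(G)$ is the maximum size of an independent set. A graph is well-covered if all its maximal (with respect to inclusion) independent sets have the same cardinality. A graph $G$ is $1$-well-covered if $G$ is well-covered, has at least two vertices, and $G-v$ is well-covered for every vertex $v$ of $G$. $s_0=1$. -}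

module Defs where

open import Data.Bool using (Bool; true; false)
open import Data.Nat using (ℕ; zero; suc; _≤_; _≟_)
open import Data.Fin using (Fin; punchIn)
open import Data.Fin.Subset using (Subset; _∈_; _∉_; ∣_∣; inside; outside)
open import Data.Fin.Subset.Properties using (_∈?_)
open import Data.Fin.Properties using (all?)
open import Data.List using (List; []; _∷_; map; _++_; filter; length)
open import Data.Vec using (Vec; []; _∷_)
open import Data.Product using (Σ; _×_; _,_)
open import Data.Empty using (⊥)
open import Relation.Nullary using (¬_; Dec; yes; no)
open import Relation.Nullary.Decidable using (_×-dec_; _→-dec_)
open import Relation.Binary.PropositionalEquality using (_≡_)
open import Relation.Binary.Construct.Closure.ReflexiveTransitive using (Star)

record Graph (n : ℕ) : Set where
  field
    adj   : Fin n → Fin n → Bool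
    sym   : ∀ i j → adj i j ≡ adj j i
    irrefl : ∀ i → adj i i ≡ false
open Graph public

Adj : ∀ {n} → Graph n → Fin n → Fin n → Set
Adj G i j = adj G i j ≡ true

Connected : ∀ {n} → Graph n → Set
Connected G = ∀ u v → Star (Adj G) u v

Independent : ∀ {n} → Graph n → Subset n → Set
Independent G S = ∀ i j → i ∈ S → j ∈ S → adj G i j ≡ false

MaximalIndependent : ∀ {n} → Graph n → Subset n → Set
MaximalIndependent {n} G S =
  Independent G S × (∀ (T : Subset n) → Independent G T → (∀ i → i ∈ S → i ∈ T) → T ≡ S)

WellCovered : ∀ {n} → Graph n → Set
WellCovered {n} G = ∀ (S T : Subset n) → MaximalIndependent G S → MaximalIndependent G T → ∣ S ∣ ≡ ∣ T ∣

deleteVertex : ∀ {m} → Graph (suc m) → Fin (suc m) → Graph m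
deleteVertex G v = record
  { adj = λ i j → adj G (punchIn v i) (punchIn v j)
  ; sym = λ i j → sym G (punchIn v i) (punchIn v j)
  ; irrefl = λ i → irrefl G (punchIn v i) }

OneWellCovered : ∀ {n} → Graph n → Set
OneWellCovered {zero} G = ⊥
OneWellCovered {suc m} G =
  WellCovered G × (2 ≤ suc m) × (∀ v → WellCovered (deleteVertex G v))

IsIndependenceNumber : ∀ {n} → Graph n → ℕ → Set
IsIndependenceNumber {n} G a =
  Σ (Subset n) (λ S → Independent G S × ∣ S ∣ ≡ a) ×
  (∀ (S : Subset n) → Independent G S → ∣ S ∣ ≤ a)

allSubsets : ∀ n → List (Subset n)
allSubsets zero = [] ∷ []
allSubsets (suc n) = map (outside ∷_) (allSubsets n) ++ map (inside ∷_) (allSubsets n)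

independent? : ∀ {n} (G : Graph n) (S : Subset n) → Dec (Independent G S)
independent? G S = all? λ i → all? λ j → (i ∈? S) →-dec ((j ∈? S) →-dec (Data.Bool._≟_ (adj G i j) false))
  where import Data.Bool

s : ∀ {n} → Graph n → ℕ → ℕ
s {n} G k = length (filter (λ S → independent? G S ×-dec (∣ S ∣ ≟ k)) (allSubsets n))

-- For an independent set S write a(S) for the number of vertices that can be added to S. Counting pairs (T, v)
-- with v ∈ T in two ways gives (k + 1)·s_{k+1} = Σ_{|S| = k} a(S), so (i)–(iv) reduce to bounds on a(S).
-- Lower bound: if w is addable to S, extend S to a maximal independent set J of G − w; as G − w is
-- well-covered, J has α vertices, so w has a neighbour in J, and that neighbour is addable to S as well.
-- Adding w and iterating up to size α gives a(S) ≥ 2(α − |S|), which is (i); (ii) follows.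
-- Upper bound: every x ∈ S has a private neighbour, since otherwise a maximal extension T of S would leave
-- T − x maximal in the well-covered G − x with only α − 1 vertices; with minimum degree two this gives
-- |N(S)| ≥ |S| + 1, hence a(S) ≤ n − 2|S| − 1, which is (iii), and (iv) follows.
module Submission where

open import Defs hiding (sym)
open import Data.Nat using (ℕ; zero; suc; _+_; _*_; _∸_; _≤_; _<_; _/_; _%_; z≤n; s≤s; s≤s⁻¹)
import Data.Nat as ℕ
open import Data.Nat.Properties hiding (_≟_)
open import Data.Nat.DivMod using (m/n*n≤m; m≡m%n+[m/n]*n; m%n<n)
open import Data.Nat.Solver using (module +-*-Solver)
open import Data.Nat.ListAction using () renaming (sum to sumₗ)
open import Data.Nat.ListAction.Properties using () renaming (sum-++ to sumₗ-++)
open import Algebra.Properties.CommutativeSemigroup +-commutativeSemigroup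
  using () renaming (interchange to +-interchange)
open import Algebra.Properties.Semiring.Sum +-*-semiring
  using (sum; sum-syntax; ∑-distrib-+; sum-remove; sum-replicate-zero; *-distribʳ-sum; sum-cong-≗)
open import Data.Bool as Bool using (true; false; not; if_then_else_)
open import Data.Bool.Properties using (not-involutive; ¬-not)
open import Data.Empty using (⊥-elim)
open import Data.Fin using (Fin; zero; suc; punchIn)
open import Data.Fin.Properties using (_≟_; punchInᵢ≢i; punchIn-punchOut; all?; any?; ¬∀⟶∃¬)
open import Data.Fin.Subset using (Subset; _∈_; _∉_; _⊆_; ∣_∣; inside; outside; ⊥; ⊤; ⁅_⁆; Nonempty)
open import Data.Fin.Subset.Properties
  using (_∈?_; ∉⊥; ∣⊥∣≡0; ⊆-antisym; ∣p∣≤n; p⊆q⇒∣p∣≤∣q∣; ∣⊤∣≡n; x∈⁅x⁆; x∈⁅y⁆⇒x≡y; x≢y⇒x∉⁅y⁆; ∣⁅x⁆∣≡1)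
open import Data.List using (List; []; _∷_; map; filter; length; _++_)
open import Data.List.Properties using (map-++; map-∘)
open import Data.Product using (_×_; ∃; _,_; proj₁; proj₂)
open import Data.Sum using (_⊎_; inj₁; inj₂)
open import Data.Vec using (Vec; []; _∷_; lookup; updateAt; removeAt; insertAt; _[_]=_; here; there)
open import Data.Vec.Properties
  using ( []=⇒lookup; lookup⇒[]=; []=-injective; updateAt-updates; updateAt-minimal; updateAt-updateAt
        ; updateAt-cong; updateAt-id; removeAt-insertAt; insertAt-lookup; insertAt-punchIn)
open import Function using (id; _∘_; _⇔_; mk⇔; Equivalence; const; flip)
open import Level using (Level)
open import Relation.Binary.Construct.Closure.ReflexiveTransitive using (Star; ε; _◅_)
open import Relation.Binary.PropositionalEquality
  using (_≡_; _≢_; refl; sym; trans; cong; cong₂; subst; subst₂; module ≡-Reasoning)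
open import Relation.Nullary using (¬_; Dec; yes; no; does; contradiction)
open import Relation.Nullary.Decidable using (_×-dec_; _⊎-dec_; _→-dec_; ¬?; decidable-stable)
open import Relation.Unary using (Decidable)

open +-*-Solver using (solve; _:+_; _:*_; con; _:=_)

-- Indicators and finite sums

private
  variable
    p q r : Level
    P : Set p
    Q : Set q
    R : Set r

⟦_⟧ : Dec P → ℕ
⟦ P? ⟧ = if does P? then 1 else 0

⟦⟧-yes : (P? : Dec P) → P → ⟦ P? ⟧ ≡ 1
⟦⟧-yes (yes _) _ = refl
⟦⟧-yes (no ¬p) p = contradiction p ¬p

⟦⟧-no : (P? : Dec P) → ¬ P → ⟦ P? ⟧ ≡ 0
⟦⟧-no (yes p) ¬p = contradiction p ¬p
⟦⟧-no (no _) _ = refl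

⟦⟧-mono : (P → Q) → (P? : Dec P) (Q? : Dec Q) → ⟦ P? ⟧ ≤ ⟦ Q? ⟧
⟦⟧-mono f (yes p) Q? = ≤-reflexive (sym (⟦⟧-yes Q? (f p)))
⟦⟧-mono f (no _) Q? = z≤n

⟦⟧-cong : P ⇔ Q → (P? : Dec P) (Q? : Dec Q) → ⟦ P? ⟧ ≡ ⟦ Q? ⟧
⟦⟧-cong P⇔Q P? Q? =
  ≤-antisym (⟦⟧-mono (Equivalence.to P⇔Q) P? Q?) (⟦⟧-mono (Equivalence.from P⇔Q) Q? P?)

⟦×-dec⟧ : (P? : Dec P) (Q? : Dec Q) → ⟦ P? ×-dec Q? ⟧ ≡ ⟦ P? ⟧ * ⟦ Q? ⟧
⟦×-dec⟧ (yes _) (yes _) = refl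
⟦×-dec⟧ (yes _) (no _) = refl
⟦×-dec⟧ (no _) _ = refl

⟦⊎-dec⟧ : (P → ¬ Q) → (P? : Dec P) (Q? : Dec Q) → ⟦ P? ⊎-dec Q? ⟧ ≡ ⟦ P? ⟧ + ⟦ Q? ⟧
⟦⊎-dec⟧ P→¬Q (yes p) (yes q) = contradiction q (P→¬Q p)
⟦⊎-dec⟧ _ (yes _) (no _) = refl
⟦⊎-dec⟧ _ (no _) (yes _) = refl
⟦⊎-dec⟧ _ (no _) (no _) = refl

⟦⟧-+-≤ : (P → ¬ Q) → (P ⊎ Q → R) → (P? : Dec P) (Q? : Dec Q) (R? : Dec R) →
         ⟦ P? ⟧ + ⟦ Q? ⟧ ≤ ⟦ R? ⟧
⟦⟧-+-≤ P→¬Q P⊎Q→R P? Q? R? =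
  subst (_≤ ⟦ R? ⟧) (⟦⊎-dec⟧ P→¬Q P? Q?) (⟦⟧-mono P⊎Q→R (P? ⊎-dec Q?) R?)

⟦⟧-partition : (P? : Dec P) (Q? : Dec Q) →
               ⟦ P? ⟧ + ⟦ ¬? P? ×-dec Q? ⟧ + ⟦ ¬? P? ×-dec ¬? Q? ⟧ ≡ 1
⟦⟧-partition (yes _) _ = refl
⟦⟧-partition (no _) (yes _) = refl
⟦⟧-partition (no _) (no _) = refl

⟦⟧-weight-≤ : ∀ {a b} (P? : Dec P) → (P → a ≤ b) → a * ⟦ P? ⟧ ≤ b * ⟦ P? ⟧
⟦⟧-weight-≤ (yes p) a≤b = *-monoˡ-≤ 1 (a≤b p)
⟦⟧-weight-≤ {a = a} {b} (no _) _ = ≤-reflexive (trans (*-zeroʳ a) (sym (*-zeroʳ b)))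

∑-mono-≤ : ∀ {n} {f g : Fin n → ℕ} → (∀ i → f i ≤ g i) → sum f ≤ sum g
∑-mono-≤ {zero} f≤g = z≤n
∑-mono-≤ {suc n} f≤g = +-mono-≤ (f≤g zero) (∑-mono-≤ (f≤g ∘ suc))

∑-const-1 : ∀ n → ∑[ i < n ] 1 ≡ n
∑-const-1 zero = refl
∑-const-1 (suc n) = cong suc (∑-const-1 n)

∑-δ : ∀ {n} (w : Fin n) → ∑[ v < n ] ⟦ v ≟ w ⟧ ≡ 1
∑-δ {suc n} w = begin
  ∑[ v < suc n ] ⟦ v ≟ w ⟧                     ≡⟨ sum-remove {i = w} (λ v → ⟦ v ≟ w ⟧) ⟩
  ⟦ w ≟ w ⟧ + ∑[ v < n ] ⟦ punchIn w v ≟ w ⟧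
    ≡⟨ cong₂ _+_ (⟦⟧-yes (w ≟ w) refl) (trans (sum-cong-≗ (λ v → ⟦⟧-no (punchIn w v ≟ w) (punchInᵢ≢i w v)))
                                              (sum-replicate-zero n)) ⟩
  1                                            ∎
  where open ≡-Reasoning

∑-+δ : ∀ {n} (f : Fin n → ℕ) (w : Fin n) → ∑[ v < n ] (f v + ⟦ v ≟ w ⟧) ≡ sum f + 1
∑-+δ f w = trans (∑-distrib-+ f _) (cong (sum f +_) (∑-δ w))

∈-lookup : ∀ {m n} {S : Subset m} {T : Subset n} {i j} → lookup S i ≡ lookup T j → i ∈ S → j ∈ T
∈-lookup {T = T} {j = j} eq i∈S = lookup⇒[]= j T (trans (sym eq) ([]=⇒lookup i∈S))

∉⇒[]=outside : ∀ {n} {S : Subset n} {v} → v ∉ S → S [ v ]= outside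
∉⇒[]=outside {S = S} {v} v∉S = lookup⇒[]= v S (¬-not (v∉S ∘ lookup⇒[]= v S))

∣∣≡∑ : ∀ {n} (S : Subset n) → ∣ S ∣ ≡ ∑[ i < n ] ⟦ i ∈? S ⟧
∣∣≡∑ [] = refl
∣∣≡∑ (inside ∷ S) = cong suc (∣∣≡∑ S)
∣∣≡∑ (outside ∷ S) = ∣∣≡∑ S

∣p∣<∣q∣⇒∃∈q∖p : ∀ {n} {p q : Subset n} → ∣ p ∣ < ∣ q ∣ → ∃ λ w → w ∈ q × w ∉ p
∣p∣<∣q∣⇒∃∈q∖p {p = p} {q} ∣p∣<∣q∣ with any? (λ w → w ∈? q ×-dec ¬? (w ∈? p))
... | yes found = found
... | no none = contradiction (p⊆q⇒∣p∣≤∣q∣ q⊆p) (<⇒≱ ∣p∣<∣q∣)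
  where
  q⊆p : q ⊆ p
  q⊆p {w} w∈q = decidable-stable (w ∈? p) (λ w∉p → none (w , w∈q , w∉p))

∣p∣≡1+j⇒Nonempty : ∀ {n} {p : Subset n} {j} → ∣ p ∣ ≡ suc j → Nonempty p
∣p∣≡1+j⇒Nonempty {n} ∣p∣≡1+j =
  let (x , x∈p , _) = ∣p∣<∣q∣⇒∃∈q∖p {p = ⊥} (subst₂ _<_ (sym (∣⊥∣≡0 n)) (sym ∣p∣≡1+j) (s≤s z≤n))
  in x , x∈p

-- S ∪ {v} or S − v; being an involution, it reindexes sums over all subsets (∑ˢ-toggle).
toggle : ∀ {n} → Fin n → Subset n → Subset n
toggle v S = updateAt S v not

module _ {n} {S : Subset n} where

  toggle-involutive : ∀ v → toggle v (toggle v S) ≡ S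
  toggle-involutive v =
    trans (updateAt-updateAt v S) (trans (updateAt-cong v not-involutive S) (updateAt-id v S))

  ∈-toggle⁺ : ∀ {u v} → u ≢ v → u ∈ S → u ∈ toggle v S
  ∈-toggle⁺ {u} {v} u≢v = updateAt-minimal u v S u≢v

  ∈-toggle⁻ : ∀ {u v} → u ≢ v → u ∈ toggle v S → u ∈ S
  ∈-toggle⁻ {u} {v} u≢v u∈ =
    subst (u ∈_) (toggle-involutive v) (updateAt-minimal u v (toggle v S) u≢v u∈)

  ∈-toggle-∉ : ∀ {v} → v ∉ S → v ∈ toggle v S
  ∈-toggle-∉ {v} v∉S = updateAt-updates v S (∉⇒[]=outside v∉S)

  ∉-toggle-∈ : ∀ {v} → v ∈ S → v ∉ toggle v S
  ∉-toggle-∈ {v} v∈S v∈S′ with () ← []=-injective (updateAt-updates v S v∈S) v∈S′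

⊆-toggle : ∀ {n} {S : Subset n} {v} → v ∉ S → S ⊆ toggle v S
⊆-toggle v∉S u∈S = ∈-toggle⁺ (λ { refl → v∉S u∈S }) u∈S

toggle-⊆ : ∀ {n} {S : Subset n} {v} → v ∈ S → toggle v S ⊆ S
toggle-⊆ v∈S {u} u∈ = ∈-toggle⁻ (λ { refl → ∉-toggle-∈ v∈S u∈ }) u∈

∣toggle∣-∉ : ∀ {n} {S : Subset n} v → v ∉ S → ∣ toggle v S ∣ ≡ suc ∣ S ∣
∣toggle∣-∉ {S = outside ∷ S} zero _ = refl
∣toggle∣-∉ {S = inside ∷ S} zero v∉S = contradiction here v∉S
∣toggle∣-∉ {S = outside ∷ S} (suc v) v∉S = ∣toggle∣-∉ v (v∉S ∘ there)
∣toggle∣-∉ {S = inside ∷ S} (suc v) v∉S = cong suc (∣toggle∣-∉ v (v∉S ∘ there))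

∣toggle∣-∈ : ∀ {n} {S : Subset n} v → v ∈ S → suc ∣ toggle v S ∣ ≡ ∣ S ∣
∣toggle∣-∈ {S = S} v v∈S =
  trans (sym (∣toggle∣-∉ v (∉-toggle-∈ v∈S))) (cong ∣_∣ (toggle-involutive {S = S} v))

lookup-removeAt : ∀ {a} {A : Set a} {n} (xs : Vec A (suc n)) w i →
                  lookup (removeAt xs w) i ≡ lookup xs (punchIn w i)
lookup-removeAt (x ∷ xs) zero i = refl
lookup-removeAt (x ∷ y ∷ xs) (suc w) zero = refl
lookup-removeAt (x ∷ y ∷ xs) (suc w) (suc i) = lookup-removeAt (y ∷ xs) w i

module _ {n} (S : Subset (suc n)) (w : Fin (suc n)) where

  ∈-removeAt⁺ : ∀ {i} → punchIn w i ∈ S → i ∈ removeAt S w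
  ∈-removeAt⁺ = ∈-lookup (sym (lookup-removeAt S w _))

  ∈-removeAt⁻ : ∀ {i} → i ∈ removeAt S w → punchIn w i ∈ S
  ∈-removeAt⁻ = ∈-lookup (lookup-removeAt S w _)

  ∣∣-removeAt : ∣ S ∣ ≡ ⟦ w ∈? S ⟧ + ∣ removeAt S w ∣
  ∣∣-removeAt = begin
    ∣ S ∣                                           ≡⟨ ∣∣≡∑ S ⟩
    ∑[ i < suc n ] ⟦ i ∈? S ⟧                       ≡⟨ sum-remove {i = w} (λ i → ⟦ i ∈? S ⟧) ⟩
    ⟦ w ∈? S ⟧ + ∑[ i < n ] ⟦ punchIn w i ∈? S ⟧    ≡⟨ cong (⟦ w ∈? S ⟧ +_) (sum-cong-≗ indicator-removeAt) ⟩
    ⟦ w ∈? S ⟧ + ∑[ i < n ] ⟦ i ∈? removeAt S w ⟧   ≡⟨ cong (⟦ w ∈? S ⟧ +_) (sym (∣∣≡∑ (removeAt S w))) ⟩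
    ⟦ w ∈? S ⟧ + ∣ removeAt S w ∣                   ∎
    where
    open ≡-Reasoning
    indicator-removeAt : ∀ i → ⟦ punchIn w i ∈? S ⟧ ≡ ⟦ i ∈? removeAt S w ⟧
    indicator-removeAt i = ⟦⟧-cong (mk⇔ ∈-removeAt⁺ ∈-removeAt⁻) (punchIn w i ∈? S) (i ∈? removeAt S w)

module _ {n} (J : Subset n) (w : Fin (suc n)) where

  ∉-insertAt : w ∉ insertAt J w outside
  ∉-insertAt w∈ with () ← trans (sym (insertAt-lookup J w outside)) ([]=⇒lookup w∈)

  ∈-insertAt⁺ : ∀ {i} → i ∈ J → punchIn w i ∈ insertAt J w outside
  ∈-insertAt⁺ = ∈-lookup (sym (insertAt-punchIn J w outside _))

  ∈-insertAt⁻ : ∀ {i} → punchIn w i ∈ insertAt J w outside → i ∈ J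
  ∈-insertAt⁻ = ∈-lookup (insertAt-punchIn J w outside _)

  ∣insertAt-outside∣ : ∣ insertAt J w outside ∣ ≡ ∣ J ∣
  ∣insertAt-outside∣ = trans (∣∣-removeAt (insertAt J w outside) w)
    (cong₂ _+_ (⟦⟧-no (w ∈? insertAt J w outside) ∉-insertAt)
               (cong ∣_∣ (removeAt-insertAt J w outside)))

∑ˢ : ∀ n → (Subset n → ℕ) → ℕ
∑ˢ zero f = f []
∑ˢ (suc n) f = ∑ˢ n (f ∘ (outside ∷_)) + ∑ˢ n (f ∘ (inside ∷_))

∑ˢ-cong : ∀ n {f g : Subset n → ℕ} → (∀ S → f S ≡ g S) → ∑ˢ n f ≡ ∑ˢ n g
∑ˢ-cong zero f≡g = f≡g []
∑ˢ-cong (suc n) f≡g =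
  cong₂ _+_ (∑ˢ-cong n (f≡g ∘ (outside ∷_))) (∑ˢ-cong n (f≡g ∘ (inside ∷_)))

∑ˢ-mono-≤ : ∀ n {f g : Subset n → ℕ} → (∀ S → f S ≤ g S) → ∑ˢ n f ≤ ∑ˢ n g
∑ˢ-mono-≤ zero f≤g = f≤g []
∑ˢ-mono-≤ (suc n) f≤g =
  +-mono-≤ (∑ˢ-mono-≤ n (f≤g ∘ (outside ∷_))) (∑ˢ-mono-≤ n (f≤g ∘ (inside ∷_)))

∑ˢ-distrib-+ : ∀ n (f g : Subset n → ℕ) → ∑ˢ n (λ S → f S + g S) ≡ ∑ˢ n f + ∑ˢ n g
∑ˢ-distrib-+ zero f g = refl
∑ˢ-distrib-+ (suc n) f g = trans
  (cong₂ _+_ (∑ˢ-distrib-+ n (f ∘ (outside ∷_)) (g ∘ (outside ∷_)))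
             (∑ˢ-distrib-+ n (f ∘ (inside ∷_)) (g ∘ (inside ∷_))))
  (+-interchange (∑ˢ n (f ∘ (outside ∷_))) _ _ _)

*-distribˡ-∑ˢ : ∀ n c (f : Subset n → ℕ) → c * ∑ˢ n f ≡ ∑ˢ n (λ S → c * f S)
*-distribˡ-∑ˢ zero c f = refl
*-distribˡ-∑ˢ (suc n) c f = trans (*-distribˡ-+ c _ _)
  (cong₂ _+_ (*-distribˡ-∑ˢ n c (f ∘ (outside ∷_))) (*-distribˡ-∑ˢ n c (f ∘ (inside ∷_))))

∑ˢ-comm-∑ : ∀ n {m} (g : Subset n → Fin m → ℕ) →
            ∑ˢ n (λ S → ∑[ v < m ] g S v) ≡ ∑[ v < m ] ∑ˢ n (λ S → g S v)
∑ˢ-comm-∑ zero g = refl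
∑ˢ-comm-∑ (suc n) g = trans
  (cong₂ _+_ (∑ˢ-comm-∑ n (g ∘ (outside ∷_))) (∑ˢ-comm-∑ n (g ∘ (inside ∷_))))
  (sym (∑-distrib-+ (λ v → ∑ˢ n (λ S → g (outside ∷ S) v)) _))

∑ˢ-toggle : ∀ n (v : Fin n) (f : Subset n → ℕ) → ∑ˢ n (f ∘ toggle v) ≡ ∑ˢ n f
∑ˢ-toggle (suc n) zero f = +-comm (∑ˢ n (f ∘ (inside ∷_))) _
∑ˢ-toggle (suc n) (suc v) f =
  cong₂ _+_ (∑ˢ-toggle n v (f ∘ (outside ∷_))) (∑ˢ-toggle n v (f ∘ (inside ∷_)))

term≤∑ˢ : ∀ n (f : Subset n → ℕ) S → f S ≤ ∑ˢ n f
term≤∑ˢ zero f [] = ≤-refl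
term≤∑ˢ (suc n) f (outside ∷ S) = ≤-trans (term≤∑ˢ n (f ∘ (outside ∷_)) S) (m≤m+n _ _)
term≤∑ˢ (suc n) f (inside ∷ S) = ≤-trans (term≤∑ˢ n (f ∘ (inside ∷_)) S) (m≤n+m _ _)

sum-map-allSubsets : ∀ n (f : Subset n → ℕ) → sumₗ (map f (allSubsets n)) ≡ ∑ˢ n f
sum-map-allSubsets zero f = +-identityʳ (f [])
sum-map-allSubsets (suc n) f = begin
  sumₗ (map f (map (outside ∷_) 𝒫 ++ map (inside ∷_) 𝒫))
    ≡⟨ cong sumₗ (map-++ f (map (outside ∷_) 𝒫) _) ⟩
  sumₗ (map f (map (outside ∷_) 𝒫) ++ map f (map (inside ∷_) 𝒫))
    ≡⟨ sumₗ-++ (map f (map (outside ∷_) 𝒫)) _ ⟩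
  sumₗ (map f (map (outside ∷_) 𝒫)) + sumₗ (map f (map (inside ∷_) 𝒫))
    ≡⟨ cong₂ _+_ (cong sumₗ (sym (map-∘ 𝒫))) (cong sumₗ (sym (map-∘ 𝒫))) ⟩
  sumₗ (map (f ∘ (outside ∷_)) 𝒫) + sumₗ (map (f ∘ (inside ∷_)) 𝒫)
    ≡⟨ cong₂ _+_ (sum-map-allSubsets n (f ∘ (outside ∷_))) (sum-map-allSubsets n (f ∘ (inside ∷_))) ⟩
  ∑ˢ (suc n) f ∎
  where
  open ≡-Reasoning
  𝒫 = allSubsets n

length-filter≡sum : ∀ {a} {A : Set a} {P : A → Set p} (P? : Decidable P) (xs : List A) →
  length (filter P? xs) ≡ sumₗ (map (λ x → ⟦ P? x ⟧) xs)
length-filter≡sum P? [] = refl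
length-filter≡sum P? (x ∷ xs) with does (P? x)
... | true = cong suc (length-filter≡sum P? xs)
... | false = length-filter≡sum P? xs

-- Independent sets

module _ {n} (G : Graph n) where

  NoNeighbourIn : Subset n → Fin n → Set
  NoNeighbourIn S v = ∀ u → u ∈ S → adj G v u ≡ false

  Addable : Subset n → Fin n → Set
  Addable S v = v ∉ S × NoNeighbourIn S v

  InNeighbourhood : Subset n → Fin n → Set
  InNeighbourhood S v = v ∉ S × ¬ NoNeighbourIn S v

  Dominating : Subset n → Set
  Dominating S = ∀ v → v ∉ S → ∃ λ u → u ∈ S × Adj G v u

  noNeighbourIn? : ∀ S v → Dec (NoNeighbourIn S v)
  noNeighbourIn? S v = all? λ u → u ∈? S →-dec (adj G v u Bool.≟ false)

  addable? : ∀ S v → Dec (Addable S v)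
  addable? S v = ¬? (v ∈? S) ×-dec noNeighbourIn? S v

  inNeighbourhood? : ∀ S v → Dec (InNeighbourhood S v)
  inNeighbourhood? S v = ¬? (v ∈? S) ×-dec ¬? (noNeighbourIn? S v)

  #addable : Subset n → ℕ
  #addable S = ∑[ v < n ] ⟦ addable? S v ⟧

  #neighbourhood : Subset n → ℕ
  #neighbourhood S = ∑[ v < n ] ⟦ inNeighbourhood? S v ⟧

  ∣∣+#addable+#neighbourhood : ∀ S → ∣ S ∣ + #addable S + #neighbourhood S ≡ n
  ∣∣+#addable+#neighbourhood S = begin
    ∣ S ∣ + #addable S + #neighbourhood S
      ≡⟨ cong (λ c → c + #addable S + #neighbourhood S) (∣∣≡∑ S) ⟩
    ∑[ v < n ] ⟦ v ∈? S ⟧ + #addable S + #neighbourhood S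
      ≡⟨ cong (_+ #neighbourhood S) (sym (∑-distrib-+ (λ v → ⟦ v ∈? S ⟧) _)) ⟩
    ∑[ v < n ] (⟦ v ∈? S ⟧ + ⟦ addable? S v ⟧) + #neighbourhood S
      ≡⟨ sym (∑-distrib-+ (λ v → ⟦ v ∈? S ⟧ + ⟦ addable? S v ⟧) _) ⟩
    ∑[ v < n ] (⟦ v ∈? S ⟧ + ⟦ addable? S v ⟧ + ⟦ inNeighbourhood? S v ⟧)
      ≡⟨ sum-cong-≗ (λ v → ⟦⟧-partition (v ∈? S) (noNeighbourIn? S v)) ⟩
    ∑[ v < n ] 1
      ≡⟨ ∑-const-1 n ⟩
    n ∎
    where open ≡-Reasoning

  neighbour-in : ∀ {S v} → ¬ NoNeighbourIn S v → ∃ λ u → u ∈ S × Adj G v u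
  neighbour-in {S} {v} ¬none with ¬∀⟶∃¬ n _ (λ u → u ∈? S →-dec (adj G v u Bool.≟ false)) ¬none
  ... | u , ¬[u∈S→nonadj] with u ∈? S
  ...   | yes u∈S = u , u∈S , ¬-not (¬[u∈S→nonadj] ∘ const)
  ...   | no u∉S = contradiction (flip contradiction u∉S) ¬[u∈S→nonadj]

  independent-⊆ : ∀ {S T} → T ⊆ S → Independent G S → Independent G T
  independent-⊆ T⊆S indS i j i∈T j∈T = indS i j (T⊆S i∈T) (T⊆S j∈T)

  independent-toggle : ∀ {S v} → Independent G S → Addable S v → Independent G (toggle v S)
  independent-toggle {S} {v} indS (v∉S , none) i j i∈ j∈ with i ≟ v | j ≟ v
  ... | yes refl | yes refl = irrefl G i
  ... | yes refl | no j≢v = none j (∈-toggle⁻ j≢v j∈)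
  ... | no i≢v | yes refl = trans (Graph.sym G i j) (none i (∈-toggle⁻ i≢v i∈))
  ... | no i≢v | no j≢v = indS i j (∈-toggle⁻ i≢v i∈) (∈-toggle⁻ j≢v j∈)

  ⁅⁆-independent : ∀ y → Independent G ⁅ y ⁆
  ⁅⁆-independent y i j i∈ j∈ with refl ← x∈⁅y⁆⇒x≡y y i∈ | refl ← x∈⁅y⁆⇒x≡y y j∈ = irrefl G i

  addable-⊆ : ∀ {S T v} → S ⊆ T → Addable T v → Addable S v
  addable-⊆ S⊆T (v∉T , free) = v∉T ∘ S⊆T , λ u u∈S → free u (S⊆T u∈S)

  dominating⇒maximal : ∀ {S} → Independent G S → Dominating S → MaximalIndependent G S
  dominating⇒maximal {S} indS domS = indS , λ T indT S⊆T → ⊆-antisym (T⊆S T indT S⊆T) (S⊆T _)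
    where
    T⊆S : ∀ T → Independent G T → (∀ i → i ∈ S → i ∈ T) → T ⊆ S
    T⊆S T indT S⊆T {v} v∈T with v ∈? S
    ... | yes v∈S = v∈S
    ... | no v∉S with domS v v∉S
    ...   | u , u∈S , adj-vu with () ← trans (sym adj-vu) (indT v u v∈T (S⊆T u u∈S))

  record Extension (S : Subset n) : Set where
    field
      set         : Subset n
      ⊇S          : S ⊆ set
      independent : Independent G set
      dominating  : Dominating set

  extend : ∀ {S} → Independent G S → Extension S
  extend {S} indS = go n S indS (m≤m+n n ∣ S ∣) id
    where
    go : ∀ fuel T → Independent G T → n ≤ fuel + ∣ T ∣ → S ⊆ T → Extension S
    go fuel T indT n≤fuel+∣T∣ S⊆T with any? (addable? T)
    ... | no ¬addable = record
      { set = T ; ⊇S = S⊆T ; independent = indT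
      ; dominating = λ v v∉T → neighbour-in (λ none → ¬addable (v , v∉T , none)) }
    ... | yes (v , v∉T , none) with fuel
    ...   | zero = contradiction (subst (_≤ n) (∣toggle∣-∉ v v∉T) (∣p∣≤n (toggle v T))) (<⇒≱ (s≤s n≤fuel+∣T∣))
    ...   | suc fuel = go fuel (toggle v T) (independent-toggle indT (v∉T , none))
      (subst (n ≤_) (trans (sym (+-suc fuel ∣ T ∣)) (cong (fuel +_) (sym (∣toggle∣-∉ v v∉T)))) n≤fuel+∣T∣)
      (⊆-toggle v∉T ∘ S⊆T)

  connected-closed-size : Connected G → ∀ {P x} → x ∈ P → (∀ {u v} → u ∈ P → Adj G u v → v ∈ P) →
                          n ≤ ∣ P ∣
  connected-closed-size connected {P} {x} x∈P closed =
    subst (_≤ ∣ P ∣) (∣⊤∣≡n n) (p⊆q⇒∣p∣≤∣q∣ {p = ⊤} (λ {v} _ → reach (connected x v) x∈P))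
    where
    reach : ∀ {u v} → Star (Adj G) u v → u ∈ P → v ∈ P
    reach ε u∈P = u∈P
    reach (adj-uw ◅ path) u∈P = reach path (closed u∈P adj-uw)

  has-neighbour : Connected G → 2 ≤ n → ∀ x → ∃ (Adj G x)
  has-neighbour connected 2≤n x with any? (λ y → adj G x y Bool.≟ true)
  ... | yes found = found
  ... | no none = contradiction (connected-closed-size connected (x∈⁅x⁆ x) closed) (<⇒≱ 1<n)
    where
    1<n : ∣ ⁅ x ⁆ ∣ < n
    1<n = subst (_< n) (sym (∣⁅x⁆∣≡1 x)) 2≤n
    closed : ∀ {u v} → u ∈ ⁅ x ⁆ → Adj G u v → v ∈ ⁅ x ⁆
    closed {u} {v} u∈ adj-uv with refl ← x∈⁅y⁆⇒x≡y x u∈ = contradiction (v , adj-uv) none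

  isolated-edge-spans : Connected G → ∀ {x y} → Adj G x y →
                        (∀ {v} → Adj G x v → v ≡ y) → (∀ {v} → Adj G y v → v ≡ x) → n ≤ 2
  isolated-edge-spans connected {x} {y} adj-xy only-y only-x = begin
    n                  ≤⟨ connected-closed-size connected x∈E closed ⟩
    ∣ E ∣              ≡⟨ ∣toggle∣-∉ y (x≢y⇒x∉⁅y⁆ y≢x) ⟩
    suc ∣ ⁅ x ⁆ ∣      ≡⟨ cong suc (∣⁅x⁆∣≡1 x) ⟩
    2                  ∎
    where
    open ≤-Reasoning
    E = toggle y ⁅ x ⁆
    y≢x : y ≢ x
    y≢x refl with () ← trans (sym adj-xy) (irrefl G x)
    x∈E : x ∈ E
    x∈E = ∈-toggle⁺ (y≢x ∘ sym) (x∈⁅x⁆ x)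
    y∈E : y ∈ E
    y∈E = ∈-toggle-∉ (x≢y⇒x∉⁅y⁆ y≢x)
    closed : ∀ {u v} → u ∈ E → Adj G u v → v ∈ E
    closed {u} u∈E adj-uv with u ≟ y
    ... | yes refl = subst (_∈ E) (sym (only-x adj-uv)) x∈E
    ... | no u≢y with refl ← x∈⁅y⁆⇒x≡y x (∈-toggle⁻ u≢y u∈E) = subst (_∈ E) (sym (only-y adj-uv)) y∈E

  #addable-toggle : ∀ {S w u} → Addable S w → Adj G w u → Addable S u →
                    #addable (toggle w S) + 2 ≤ #addable S
  #addable-toggle {S} {w} {u} w-addable@(w∉S , _) adj-wu u-addable = begin
    #addable S′ + 2
      ≡⟨ sym (+-assoc (#addable S′) 1 1) ⟩
    #addable S′ + 1 + 1
      ≡⟨ sym (trans (∑-+δ _ u) (cong (_+ 1) (∑-+δ _ w))) ⟩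
    ∑[ v < n ] (⟦ addable? S′ v ⟧ + ⟦ v ≟ w ⟧ + ⟦ v ≟ u ⟧)
      ≤⟨ ∑-mono-≤ loss ⟩
    #addable S ∎
    where
    open ≤-Reasoning
    S′ = toggle w S
    w∈S′ : w ∈ S′
    w∈S′ = ∈-toggle-∉ w∉S
    not-u : ∀ {v} → Addable S′ v ⊎ v ≡ w → v ≢ u
    not-u (inj₁ (_ , free)) refl with () ← trans (sym (trans (Graph.sym G u w) adj-wu)) (free w w∈S′)
    not-u (inj₂ refl) refl with () ← trans (sym adj-wu) (irrefl G w)
    was-addable : ∀ {v} → (Addable S′ v ⊎ v ≡ w) ⊎ v ≡ u → Addable S v
    was-addable (inj₁ (inj₁ addable′)) = addable-⊆ (⊆-toggle w∉S) addable′
    was-addable (inj₁ (inj₂ refl)) = w-addable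
    was-addable (inj₂ refl) = u-addable
    loss : ∀ v → ⟦ addable? S′ v ⟧ + ⟦ v ≟ w ⟧ + ⟦ v ≟ u ⟧ ≤ ⟦ addable? S v ⟧
    loss v = subst (λ c → c + ⟦ v ≟ u ⟧ ≤ ⟦ addable? S v ⟧)
      (⟦⊎-dec⟧ (λ { (v∉S′ , _) refl → v∉S′ w∈S′ }) (addable? S′ v) (v ≟ w))
      (⟦⟧-+-≤ not-u was-addable (addable? S′ v ⊎-dec (v ≟ w)) (v ≟ u) (addable? S v))

  #neighbourhood-toggle : ∀ {S x z} → Independent G S → x ∈ S → Adj G x z → Addable (toggle x S) z →
                          suc (#neighbourhood (toggle x S)) ≤ #neighbourhood S
  #neighbourhood-toggle {S} {x} {z} indS x∈S adj-xz (z∉S′ , z-free) = begin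
    suc (#neighbourhood S′)
      ≡⟨ +-comm 1 (#neighbourhood S′) ⟩
    #neighbourhood S′ + 1
      ≡⟨ sym (∑-+δ _ z) ⟩
    ∑[ v < n ] (⟦ inNeighbourhood? S′ v ⟧ + ⟦ v ≟ z ⟧)
      ≤⟨ ∑-mono-≤ (λ v → ⟦⟧-+-≤ not-z was-in (inNeighbourhood? S′ v) (v ≟ z) (inNeighbourhood? S v)) ⟩
    #neighbourhood S ∎
    where
    open ≤-Reasoning
    S′ = toggle x S
    not-z : ∀ {v} → InNeighbourhood S′ v → v ≢ z
    not-z (_ , attached) refl = attached z-free
    z≢x : z ≢ x
    z≢x refl with () ← trans (sym adj-xz) (irrefl G z)
    was-in : ∀ {v} → InNeighbourhood S′ v ⊎ v ≡ z → InNeighbourhood S v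
    was-in {v} (inj₁ (v∉S′ , attached)) = v∉S , λ free → attached λ u u∈S′ → free u (toggle-⊆ x∈S u∈S′)
      where
      v∉S : v ∉ S
      v∉S v∈S with v ≟ x
      ... | yes refl = attached λ u u∈S′ → indS v u v∈S (toggle-⊆ x∈S u∈S′)
      ... | no v≢x = v∉S′ (∈-toggle⁺ v≢x v∈S)
    was-in (inj₂ refl) = z∉S′ ∘ ∈-toggle⁺ z≢x , λ free →
      contradiction (trans (sym (trans (Graph.sym G z x) adj-xz)) (free x x∈S)) λ ()

  #neighbourhood-≥2 : ∀ {S x y z} → Independent G S → x ∈ S → y ≢ z → Adj G x y → Adj G x z →
                      2 ≤ #neighbourhood S
  #neighbourhood-≥2 {S} {x} {y} {z} indS x∈S y≢z adj-xy adj-xz = begin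
    2
      ≡⟨ cong (_+ 1) (sym (∑-δ y)) ⟩
    ∑[ v < n ] ⟦ v ≟ y ⟧ + 1
      ≡⟨ sym (∑-+δ _ z) ⟩
    ∑[ v < n ] (⟦ v ≟ y ⟧ + ⟦ v ≟ z ⟧)
      ≤⟨ ∑-mono-≤ (λ v → ⟦⟧-+-≤ (λ { refl → y≢z }) in-N (v ≟ y) (v ≟ z) (inNeighbourhood? S v)) ⟩
    #neighbourhood S ∎
    where
    open ≤-Reasoning
    neighbour-of-x : ∀ {v} → Adj G x v → InNeighbourhood S v
    neighbour-of-x {v} adj-xv =
      (λ v∈S → contradiction (trans (sym adj-xv) (indS x v x∈S v∈S)) λ ()) ,
      (λ free → contradiction (trans (sym (trans (Graph.sym G v x) adj-xv)) (free x x∈S)) λ ())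
    in-N : ∀ {v} → v ≡ y ⊎ v ≡ z → InNeighbourhood S v
    in-N (inj₁ refl) = neighbour-of-x adj-xy
    in-N (inj₂ refl) = neighbour-of-x adj-xz

punchIn-onto : ∀ {n} {w v : Fin (suc n)} → v ≢ w → ∃ λ i → punchIn w i ≡ v
punchIn-onto v≢w = _ , punchIn-punchOut (v≢w ∘ sym)

module _ {n} (G : Graph (suc n)) (w : Fin (suc n)) where

  removeAt-independent : ∀ {T} → Independent G T → Independent (deleteVertex G w) (removeAt T w)
  removeAt-independent {T} indT i j i∈ j∈ = indT _ _ (∈-removeAt⁻ T w i∈) (∈-removeAt⁻ T w j∈)

  removeAt-dominating : ∀ {T} → (∀ v → v ∉ T → v ≢ w → ∃ λ u → u ∈ T × u ≢ w × Adj G v u) →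
                        Dominating (deleteVertex G w) (removeAt T w)
  removeAt-dominating {T} dom i i∉ with dom (punchIn w i) (i∉ ∘ ∈-removeAt⁺ T w) (punchInᵢ≢i w i)
  ... | u , u∈T , u≢w , adj-iu with punchIn-onto u≢w
  ...   | u′ , refl = u′ , ∈-removeAt⁺ T w u∈T , adj-iu

  insertAt-independent : ∀ {J} → Independent (deleteVertex G w) J → Independent G (insertAt J w outside)
  insertAt-independent {J} indJ i j i∈ j∈
    with punchIn-onto {w = w} {i} (λ { refl → ∉-insertAt J w i∈ })
       | punchIn-onto {w = w} {j} (λ { refl → ∉-insertAt J w j∈ })
  ... | i′ , refl | j′ , refl = indJ i′ j′ (∈-insertAt⁻ J w i∈) (∈-insertAt⁻ J w j∈)

-- Counting independent sets by size

module _ {n} (G : Graph n) where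

  IndependentOfSize : ℕ → Subset n → Set
  IndependentOfSize k S = Independent G S × ∣ S ∣ ≡ k

  independentOfSize? : ∀ k S → Dec (IndependentOfSize k S)
  independentOfSize? k S = independent? G S ×-dec (∣ S ∣ ℕ.≟ k)

  χ : ℕ → Subset n → ℕ
  χ k S = ⟦ independentOfSize? k S ⟧

  s≡∑ˢχ : ∀ k → s G k ≡ ∑ˢ n (χ k)
  s≡∑ˢχ k = trans (length-filter≡sum (independentOfSize? k) (allSubsets n)) (sum-map-allSubsets n (χ k))

  independentOfSize-toggle : ∀ k S v →
    (IndependentOfSize (suc k) (toggle v S) × v ∈ toggle v S) ⇔ (IndependentOfSize k S × Addable G S v)
  independentOfSize-toggle k S v = mk⇔ to from
    where
    to : IndependentOfSize (suc k) (toggle v S) × v ∈ toggle v S → IndependentOfSize k S × Addable G S v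
    to ((indT , ∣T∣≡1+k) , v∈T) =
      (independent-⊆ G (⊆-toggle v∉S) indT , suc-injective (trans (sym (∣toggle∣-∉ v v∉S)) ∣T∣≡1+k)) ,
      v∉S , λ u u∈S → indT v u v∈T (⊆-toggle v∉S u∈S)
      where
      v∉S : v ∉ S
      v∉S v∈S = ∉-toggle-∈ v∈S v∈T
    from : IndependentOfSize k S × Addable G S v → IndependentOfSize (suc k) (toggle v S) × v ∈ toggle v S
    from ((indS , ∣S∣≡k) , addable@(v∉S , _)) =
      (independent-toggle G indS addable , trans (∣toggle∣-∉ v v∉S) (cong suc ∣S∣≡k)) , ∈-toggle-∉ v∉S

  -- Count pairs (T, v) with v ∈ T and |T| = k + 1 in two ways: by T, and by S = T − v.
  double-count : ∀ k → suc k * s G (suc k) ≡ ∑ˢ n (λ S → #addable G S * χ k S)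
  double-count k = begin
    suc k * s G (suc k)
      ≡⟨ cong (suc k *_) (s≡∑ˢχ (suc k)) ⟩
    suc k * ∑ˢ n (χ (suc k))
      ≡⟨ *-distribˡ-∑ˢ n (suc k) (χ (suc k)) ⟩
    ∑ˢ n (λ T → suc k * χ (suc k) T)
      ≡⟨ ∑ˢ-cong n (λ T → weigh-by-size T (independentOfSize? (suc k) T)) ⟩
    ∑ˢ n (λ T → ∑[ v < n ] ⟦ v ∈? T ⟧ * χ (suc k) T)
      ≡⟨ ∑ˢ-cong n (λ T → *-distribʳ-sum (χ (suc k) T) (λ v → ⟦ v ∈? T ⟧)) ⟩
    ∑ˢ n (λ T → ∑[ v < n ] pair T v)
      ≡⟨ ∑ˢ-comm-∑ n pair ⟩
    ∑[ v < n ] ∑ˢ n (λ T → pair T v)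
      ≡⟨ sum-cong-≗ (λ v → sym (∑ˢ-toggle n v (λ T → pair T v))) ⟩
    ∑[ v < n ] ∑ˢ n (λ S → pair (toggle v S) v)
      ≡⟨ sum-cong-≗ (λ v → ∑ˢ-cong n (λ S → pair-toggle S v)) ⟩
    ∑[ v < n ] ∑ˢ n (λ S → ⟦ addable? G S v ⟧ * χ k S)
      ≡⟨ sym (∑ˢ-comm-∑ n (λ S v → ⟦ addable? G S v ⟧ * χ k S)) ⟩
    ∑ˢ n (λ S → ∑[ v < n ] (⟦ addable? G S v ⟧ * χ k S))
      ≡⟨ ∑ˢ-cong n (λ S → sym (*-distribʳ-sum (χ k S) (λ v → ⟦ addable? G S v ⟧))) ⟩
    ∑ˢ n (λ S → #addable G S * χ k S) ∎
    where
    open ≡-Reasoning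
    pair : Subset n → Fin n → ℕ
    pair T v = ⟦ v ∈? T ⟧ * χ (suc k) T
    weigh-by-size : ∀ T (T? : Dec (IndependentOfSize (suc k) T)) →
                    suc k * ⟦ T? ⟧ ≡ ∑[ v < n ] ⟦ v ∈? T ⟧ * ⟦ T? ⟧
    weigh-by-size T (yes (_ , ∣T∣≡1+k)) =
      trans (*-identityʳ (suc k)) (trans (sym ∣T∣≡1+k) (trans (∣∣≡∑ T) (sym (*-identityʳ (∑[ v < n ] ⟦ v ∈? T ⟧)))))
    weigh-by-size T (no _) = trans (*-zeroʳ (suc k)) (sym (*-zeroʳ (∑[ v < n ] ⟦ v ∈? T ⟧)))
    pair-toggle : ∀ S v → pair (toggle v S) v ≡ ⟦ addable? G S v ⟧ * χ k S
    pair-toggle S v = begin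
      ⟦ v ∈? T ⟧ * χ (suc k) T                      ≡⟨ *-comm ⟦ v ∈? T ⟧ (χ (suc k) T) ⟩
      χ (suc k) T * ⟦ v ∈? T ⟧                      ≡⟨ sym (⟦×-dec⟧ (independentOfSize? (suc k) T) (v ∈? T)) ⟩
      ⟦ independentOfSize? (suc k) T ×-dec v ∈? T ⟧
        ≡⟨ ⟦⟧-cong (independentOfSize-toggle k S v)
                   (independentOfSize? (suc k) T ×-dec v ∈? T) (independentOfSize? k S ×-dec addable? G S v) ⟩
      ⟦ independentOfSize? k S ×-dec addable? G S v ⟧ ≡⟨ ⟦×-dec⟧ (independentOfSize? k S) (addable? G S v) ⟩
      χ k S * ⟦ addable? G S v ⟧                    ≡⟨ *-comm (χ k S) ⟦ addable? G S v ⟧ ⟩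
      ⟦ addable? G S v ⟧ * χ k S                    ∎
      where T = toggle v S

  s-ratio-≥ : ∀ k c → (∀ {S} → IndependentOfSize k S → c ≤ #addable G S) → c * s G k ≤ suc k * s G (suc k)
  s-ratio-≥ k c bound = begin
    c * s G k                            ≡⟨ cong (c *_) (s≡∑ˢχ k) ⟩
    c * ∑ˢ n (χ k)                       ≡⟨ *-distribˡ-∑ˢ n c (χ k) ⟩
    ∑ˢ n (λ S → c * χ k S)               ≤⟨ ∑ˢ-mono-≤ n (λ S → ⟦⟧-weight-≤ (independentOfSize? k S) bound) ⟩
    ∑ˢ n (λ S → #addable G S * χ k S)    ≡⟨ sym (double-count k) ⟩
    suc k * s G (suc k)                  ∎
    where open ≤-Reasoning

  s-ratio-< : ∀ k c → (∀ {S} → IndependentOfSize k S → #addable G S < c) → 0 < s G k →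
              suc k * s G (suc k) < c * s G k
  s-ratio-< k c bound 0<sₖ = begin-strict
    suc k * s G (suc k)                                   <⟨ m<m+n (suc k * s G (suc k)) 0<sₖ ⟩
    suc k * s G (suc k) + s G k                           ≡⟨ +-comm (suc k * s G (suc k)) (s G k) ⟩
    s G k + suc k * s G (suc k)                           ≡⟨ cong₂ _+_ (s≡∑ˢχ k) (double-count k) ⟩
    ∑ˢ n (χ k) + ∑ˢ n (λ S → #addable G S * χ k S)        ≡⟨ sym (∑ˢ-distrib-+ n (χ k) _) ⟩
    ∑ˢ n (λ S → suc (#addable G S) * χ k S)               ≤⟨ ∑ˢ-mono-≤ n (λ S → ⟦⟧-weight-≤ (independentOfSize? k S) bound) ⟩
    ∑ˢ n (λ S → c * χ k S)                                ≡⟨ sym (*-distribˡ-∑ˢ n c (χ k)) ⟩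
    c * ∑ˢ n (χ k)                                        ≡⟨ cong (c *_) (sym (s≡∑ˢχ k)) ⟩
    c * s G k                                             ∎
    where open ≤-Reasoning

-- Connected 1-well-covered graphs

module ConnectedOneWellCovered {m} (G : Graph (suc m)) {α : ℕ}
  (connected : Connected G) (2<n : 2 < suc m)
  (wellCovered : WellCovered G) (wellCovered-del : ∀ w → WellCovered (deleteVertex G w))
  (isα : IsIndependenceNumber G α) where

  ∣∣≤α : ∀ {S} → Independent G S → ∣ S ∣ ≤ α
  ∣∣≤α {S} = proj₂ isα S

  size-α⇒dominating : ∀ {S} → Independent G S → ∣ S ∣ ≡ α → Dominating G S
  size-α⇒dominating {S} indS ∣S∣≡α v v∉S = neighbour-in G λ none →
    n≮n α (subst₂ _≤_ (cong suc ∣S∣≡α) refl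
                  (subst (_≤ α) (∣toggle∣-∉ v v∉S) (∣∣≤α (independent-toggle G indS (v∉S , none)))))

  dominating-size : ∀ {S} → Independent G S → Dominating G S → ∣ S ∣ ≡ α
  dominating-size {S} indS domS = trans
    (wellCovered S A (dominating⇒maximal G indS domS) (dominating⇒maximal G indA (size-α⇒dominating indA ∣A∣≡α)))
    ∣A∣≡α
    where
    A = proj₁ (proj₁ isα)
    indA = proj₁ (proj₂ (proj₁ isα))
    ∣A∣≡α = proj₂ (proj₂ (proj₁ isα))

  -- A neighbour y of w extends to a maximal independent set T of G avoiding w, and T − w is maximal in G − w.
  dominating-size-del : ∀ w {J} → Independent (deleteVertex G w) J → Dominating (deleteVertex G w) J → ∣ J ∣ ≡ α
  dominating-size-del w {J} indJ domJ = trans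
    (wellCovered-del w J T∖w (dominating⇒maximal G-w indJ domJ)
                             (dominating⇒maximal G-w (removeAt-independent G w indT) domT∖w))
    ∣T∖w∣≡α
    where
    G-w = deleteVertex G w
    y = proj₁ (has-neighbour G connected (<⇒≤ 2<n) w)
    adj-wy = proj₂ (has-neighbour G connected (<⇒≤ 2<n) w)
    open Extension (extend G (⁅⁆-independent G y)) renaming (set to T; independent to indT; dominating to domT)
    w∉T : w ∉ T
    w∉T w∈T with () ← trans (sym adj-wy) (indT w y w∈T (⊇S (x∈⁅x⁆ y)))
    T∖w = removeAt T w
    domT∖w : Dominating G-w T∖w
    domT∖w = removeAt-dominating G w λ v v∉T _ →
      let (u , u∈T , adj-vu) = domT v v∉T in u , u∈T , (λ u≡w → w∉T (subst (_∈ T) u≡w u∈T)) , adj-vu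
    ∣T∖w∣≡α : ∣ T∖w ∣ ≡ α
    ∣T∖w∣≡α = trans (sym (trans (∣∣-removeAt T w) (cong (_+ ∣ T∖w ∣) (⟦⟧-no (w ∈? T) w∉T))))
                    (dominating-size indT domT)

  removeAt-not-dominating : ∀ {T x} → Independent G T → x ∈ T → ¬ Dominating (deleteVertex G x) (removeAt T x)
  removeAt-not-dominating {T} {x} indT x∈T domT∖x = n≮n α (begin-strict
    α                                  <⟨ n<1+n α ⟩
    suc α                              ≡⟨ cong suc (sym (dominating-size-del x (removeAt-independent G x indT) domT∖x)) ⟩
    suc ∣ removeAt T x ∣               ≡⟨ cong (_+ ∣ removeAt T x ∣) (sym (⟦⟧-yes (x ∈? T) x∈T)) ⟩
    ⟦ x ∈? T ⟧ + ∣ removeAt T x ∣      ≡⟨ sym (∣∣-removeAt T x) ⟩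
    ∣ T ∣                              ≤⟨ ∣∣≤α indT ⟩
    α                                  ∎)
    where open ≤-Reasoning

  ¬redominated-without : ∀ {T x} → Independent G T → Dominating G T → x ∈ T →
                         ¬ (∀ v → v ∉ T → Adj G x v → ∃ λ u → u ∈ T × u ≢ x × Adj G v u)
  ¬redominated-without {T} {x} indT domT x∈T redominated =
    removeAt-not-dominating indT x∈T (removeAt-dominating G x dom)
    where
    dom : ∀ v → v ∉ T → v ≢ x → ∃ λ u → u ∈ T × u ≢ x × Adj G v u
    dom v v∉T _ with domT v v∉T
    ... | u , u∈T , adj-vu with u ≟ x
    ...   | yes refl = redominated v v∉T (trans (Graph.sym G u v) adj-vu)
    ...   | no u≢x = u , u∈T , u≢x , adj-vu

  private-neighbour : ∀ {S x} → Independent G S → x ∈ S → ∃ λ z → Adj G x z × Addable G (toggle x S) z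
  private-neighbour {S} {x} indS x∈S with any? (λ z → (adj G x z Bool.≟ true) ×-dec addable? G (toggle x S) z)
  ... | yes found = found
  ... | no none = ⊥-elim (¬redominated-without indT domT (⊇S x∈S) redominated)
    where
    open Extension (extend G indS) renaming (set to T; independent to indT; dominating to domT)
    redominated : ∀ v → v ∉ T → Adj G x v → ∃ λ u → u ∈ T × u ≢ x × Adj G v u
    redominated v v∉T adj-xv with neighbour-in G (λ free → none (v , adj-xv , v∉T ∘ ⊇S ∘ toggle-⊆ x∈S , free))
    ... | u , u∈S∖x , adj-vu = u , ⊇S (toggle-⊆ x∈S u∈S∖x) , (λ { refl → ∉-toggle-∈ x∈S u∈S∖x }) , adj-vu

  extend-avoiding : ∀ {S w} → Independent G S → w ∉ S →
                    ∃ λ J → S ⊆ J × w ∉ J × Independent G J × ∣ J ∣ ≡ α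
  extend-avoiding {S} {w} indS w∉S =
    insertAt J′ w outside , S⊆J , ∉-insertAt J′ w , insertAt-independent G w indJ′ ,
    trans (∣insertAt-outside∣ J′ w) (dominating-size-del w indJ′ domJ′)
    where
    open Extension (extend (deleteVertex G w) (removeAt-independent G w indS))
      renaming (set to J′; ⊇S to ⊇S′; independent to indJ′; dominating to domJ′)
    S⊆J : S ⊆ insertAt J′ w outside
    S⊆J {i} i∈S with punchIn-onto {w = w} {i} (λ { refl → w∉S i∈S })
    ... | i′ , refl = ∈-insertAt⁺ J′ w (⊇S′ (∈-removeAt⁺ S w i∈S))

  addable-neighbour : ∀ {S w} → Independent G S → Addable G S w → ∃ λ u → Adj G w u × Addable G S u
  addable-neighbour {S} {w} indS (w∉S , w-free) =
    let (J , S⊆J , w∉J , indJ , ∣J∣≡α) = extend-avoiding indS w∉S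
        (u , u∈J , adj-wu) = size-α⇒dominating indJ ∣J∣≡α w w∉J
        u∉S : u ∉ S
        u∉S u∈S = contradiction (trans (sym adj-wu) (w-free u u∈S)) λ ()
    in u , adj-wu , u∉S , λ s s∈S → indJ u s u∈J (S⊆J s∈S)

  -- If y were the only neighbour of x but had a further neighbour w, a maximal independent set T ∋ w would
  -- contain x, and T − x would still dominate G − x.
  pendant-neighbour-pendant : ∀ {x y} → Adj G x y → (∀ {v} → Adj G x v → v ≡ y) → ∀ {w} → Adj G y w → w ≡ x
  pendant-neighbour-pendant {x} {y} adj-xy only-y {w} adj-yw =
    decidable-stable (w ≟ x) λ w≢x → ¬redominated-without indT domT x∈T (redominated w≢x)
    where
    open Extension (extend G (⁅⁆-independent G w)) renaming (set to T; independent to indT; dominating to domT)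
    w∈T = ⊇S (x∈⁅x⁆ w)
    y∉T : y ∉ T
    y∉T y∈T with () ← trans (sym adj-yw) (indT y w y∈T w∈T)
    x∈T : x ∈ T
    x∈T = decidable-stable (x ∈? T) λ x∉T →
      let (u , u∈T , adj-xu) = domT x x∉T in y∉T (subst (_∈ T) (only-y adj-xu) u∈T)
    redominated : w ≢ x → ∀ v → v ∉ T → Adj G x v → ∃ λ u → u ∈ T × u ≢ x × Adj G v u
    redominated w≢x v _ adj-xv with refl ← only-y adj-xv = w , w∈T , w≢x , adj-yw

  degree-two : ∀ x → ∃ λ y → ∃ λ z → y ≢ z × Adj G x y × Adj G x z
  degree-two x with has-neighbour G connected (<⇒≤ 2<n) x
  ... | y , adj-xy with any? (λ z → (adj G x z Bool.≟ true) ×-dec ¬? (z ≟ y))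
  ...   | yes (z , adj-xz , z≢y) = y , z , z≢y ∘ sym , adj-xy , adj-xz
  ...   | no ¬other = contradiction (isolated-edge-spans G connected adj-xy only-y y-pendant) (<⇒≱ 2<n)
    where
    only-y : ∀ {v} → Adj G x v → v ≡ y
    only-y {v} adj-xv = decidable-stable (v ≟ y) λ v≢y → ¬other (v , adj-xv , v≢y)
    y-pendant : ∀ {w} → Adj G y w → w ≡ x
    y-pendant = pendant-neighbour-pendant adj-xy only-y

  #addable-lower : ∀ d {S} → Independent G S → d + ∣ S ∣ ≤ α → 2 * d ≤ #addable G S
  #addable-lower zero _ _ = z≤n
  #addable-lower (suc d) {S} indS 1+d+∣S∣≤α =
    let (w , w∈T , w∉S) = new-vertex
        w-addable : Addable G S w
        w-addable = w∉S , λ s s∈S → indT w s w∈T (⊇S s∈S)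
        (u , adj-wu , u-addable) = addable-neighbour indS w-addable
        d+∣S′∣≤α : d + ∣ toggle w S ∣ ≤ α
        d+∣S′∣≤α = subst (_≤ α) (trans (sym (+-suc d ∣ S ∣)) (cong (d +_) (sym (∣toggle∣-∉ w w∉S)))) 1+d+∣S∣≤α
    in begin
      2 * suc d                      ≡⟨ *-suc 2 d ⟩
      2 + 2 * d                      ≤⟨ +-monoʳ-≤ 2 (#addable-lower d (independent-toggle G indS w-addable) d+∣S′∣≤α) ⟩
      2 + #addable G (toggle w S)    ≡⟨ +-comm 2 (#addable G (toggle w S)) ⟩
      #addable G (toggle w S) + 2    ≤⟨ #addable-toggle G w-addable adj-wu u-addable ⟩
      #addable G S                   ∎
    where
    open ≤-Reasoning
    open Extension (extend G indS) renaming (set to T; independent to indT; dominating to domT)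
    new-vertex : ∃ λ w → w ∈ T × w ∉ S
    new-vertex = ∣p∣<∣q∣⇒∃∈q∖p
      (subst (∣ S ∣ <_) (sym (dominating-size indT domT)) (≤-trans (s≤s (m≤n+m ∣ S ∣ d)) 1+d+∣S∣≤α))

  #neighbourhood-lower : ∀ j {S} → Independent G S → ∣ S ∣ ≡ suc j → suc ∣ S ∣ ≤ #neighbourhood G S
  #neighbourhood-lower j {S} indS ∣S∣≡1+j with ∣p∣≡1+j⇒Nonempty {p = S} ∣S∣≡1+j
  #neighbourhood-lower zero {S} indS ∣S∣≡1 | x , x∈S =
    let (y , z , y≢z , adj-xy , adj-xz) = degree-two x
    in subst (_≤ #neighbourhood G S) (cong suc (sym ∣S∣≡1)) (#neighbourhood-≥2 G indS x∈S y≢z adj-xy adj-xz)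
  #neighbourhood-lower (suc j) {S} indS ∣S∣≡2+j | x , x∈S =
    let (z , adj-xz , z-addable) = private-neighbour indS x∈S
        ∣S∖x∣≡1+j = suc-injective (trans (∣toggle∣-∈ x x∈S) ∣S∣≡2+j)
        ind-S∖x = independent-⊆ G (toggle-⊆ x∈S) indS
    in begin
      suc ∣ S ∣                                 ≡⟨ cong suc (sym (∣toggle∣-∈ x x∈S)) ⟩
      suc (suc ∣ toggle x S ∣)                  ≤⟨ s≤s (#neighbourhood-lower j ind-S∖x ∣S∖x∣≡1+j) ⟩
      suc (#neighbourhood G (toggle x S))       ≤⟨ #neighbourhood-toggle G indS x∈S adj-xz z-addable ⟩
      #neighbourhood G S                        ∎
    where open ≤-Reasoning

  #addable-upper : ∀ j {S} → Independent G S → ∣ S ∣ ≡ suc j → #addable G S < suc m ∸ 2 * suc j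
  #addable-upper j {S} indS ∣S∣≡1+j =
    subst (λ c → #addable G S < suc m ∸ 2 * c) ∣S∣≡1+j (m+n≤o⇒m≤o∸n (suc (#addable G S)) (begin
      suc (#addable G S) + 2 * ∣ S ∣
        ≡⟨ solve 2 (λ a b → con 1 :+ a :+ con 2 :* b := b :+ a :+ (con 1 :+ b)) refl (#addable G S) ∣ S ∣ ⟩
      ∣ S ∣ + #addable G S + suc ∣ S ∣
        ≤⟨ +-monoʳ-≤ (∣ S ∣ + #addable G S) (#neighbourhood-lower j indS ∣S∣≡1+j) ⟩
      ∣ S ∣ + #addable G S + #neighbourhood G S
        ≡⟨ ∣∣+#addable+#neighbourhood G S ⟩
      suc m ∎))
    where open ≤-Reasoning

  s-growth : ∀ k → k ≤ α → 2 * (α ∸ k) * s G k ≤ suc k * s G (suc k)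
  s-growth k k≤α = s-ratio-≥ G k (2 * (α ∸ k)) λ (indS , ∣S∣≡k) →
    #addable-lower (α ∸ k) indS (≤-reflexive (trans (cong (α ∸ k +_) ∣S∣≡k) (m∸n+n≡m k≤α)))

  s-positive : ∀ k → k ≤ α → 0 < s G k
  s-positive zero _ = begin
    1                                ≡⟨ sym (⟦⟧-yes (independentOfSize? G 0 ⊥) ((λ i _ i∈⊥ _ → contradiction i∈⊥ ∉⊥) , ∣⊥∣≡0 (suc m))) ⟩
    χ G 0 ⊥                          ≤⟨ term≤∑ˢ (suc m) (χ G 0) ⊥ ⟩
    ∑ˢ (suc m) (χ G 0)               ≡⟨ sym (s≡∑ˢχ G 0) ⟩
    s G 0                            ∎
    where open ≤-Reasoning
  s-positive (suc k) 1+k≤α = positive-factor {suc k} (begin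
    1                                ≤⟨ *-mono-≤ (m<n⇒0<n∸m 1+k≤α) (s-positive k (<⇒≤ 1+k≤α)) ⟩
    (α ∸ k) * s G k                  ≤⟨ *-monoˡ-≤ (s G k) (m≤n*m (α ∸ k) 2) ⟩
    2 * (α ∸ k) * s G k              ≤⟨ s-growth k (<⇒≤ 1+k≤α) ⟩
    suc k * s G (suc k)              ∎)
    where
    open ≤-Reasoning
    positive-factor : ∀ {a b} → 0 < a * b → 0 < b
    positive-factor {a} {zero} 0<a*0 = contradiction (subst (0 <_) (*-zeroʳ a) 0<a*0) λ ()
    positive-factor {b = suc b} _ = s≤s z≤n

  s-decay : ∀ k → 0 < k → k < α → suc k * s G (suc k) < (suc m ∸ 2 * k) * s G k
  s-decay (suc j) _ k<α = s-ratio-< G (suc j) (suc m ∸ 2 * suc j)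
    (λ (indS , ∣S∣≡1+j) → #addable-upper j indS ∣S∣≡1+j) (s-positive (suc j) (<⇒≤ k<α))

-- ⌈2α/3⌉ = ⌊(2α + 2)/3⌋ and ⌈(n − 1)/3⌉ = ⌊(n + 1)/3⌋.
k<[2α+2]/3⇒k≤α×k<2[α∸k] : ∀ {α k} → k < (2 * α + 2) / 3 → k ≤ α × suc k ≤ 2 * (α ∸ k)
k<[2α+2]/3⇒k≤α×k<2[α∸k] {α} {k} k<⌈2α/3⌉ =
  *-cancelˡ-≤ 2 (≤-trans (m≤n+m (2 * k) (suc k)) 3k+1≤2α) ,
  subst (suc k ≤_) (sym (*-distribˡ-∸ 2 α k)) (m+n≤o⇒m≤o∸n (suc k) 3k+1≤2α)
  where
  3k+1≤2α : suc k + 2 * k ≤ 2 * α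
  3k+1≤2α = +-cancelʳ-≤ 2 (suc k + 2 * k) (2 * α) (begin
    suc k + 2 * k + 2      ≡⟨ solve 1 (λ k → con 1 :+ k :+ con 2 :* k :+ con 2 := (con 1 :+ k) :* con 3) refl k ⟩
    suc k * 3              ≤⟨ *-monoˡ-≤ 3 k<⌈2α/3⌉ ⟩
    (2 * α + 2) / 3 * 3    ≤⟨ m/n*n≤m (2 * α + 2) 3 ⟩
    2 * α + 2              ∎)
    where open ≤-Reasoning

[n+1]/3≤k⇒0<k×n∸2k≤1+k : ∀ {n k} → 2 < n → (n + 1) / 3 ≤ k → 0 < k × n ∸ 2 * k ≤ suc k
[n+1]/3≤k⇒0<k×n∸2k≤1+k {n} {k} 2<n ⌈n-1/3⌉≤k = positive k n+1≤2+3k , m≤n+o⇒m∸n≤o n (2 * k) n≤2k+1+k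
  where
  n+1≤2+3k : n + 1 ≤ 2 + k * 3
  n+1≤2+3k = begin
    n + 1                              ≡⟨ m≡m%n+[m/n]*n (n + 1) 3 ⟩
    (n + 1) % 3 + (n + 1) / 3 * 3      ≤⟨ +-mono-≤ (s≤s⁻¹ (m%n<n (n + 1) 3)) (*-monoˡ-≤ 3 ⌈n-1/3⌉≤k) ⟩
    2 + k * 3                          ∎
    where open ≤-Reasoning
  positive : ∀ k → n + 1 ≤ 2 + k * 3 → 0 < k
  positive zero n+1≤2 = contradiction (≤-trans (+-monoˡ-≤ 1 2<n) n+1≤2) λ { (s≤s (s≤s ())) }
  positive (suc k) _ = s≤s z≤n
  n≤2k+1+k : n ≤ 2 * k + suc k
  n≤2k+1+k = +-cancelʳ-≤ 1 n (2 * k + suc k) (≤-trans n+1≤2+3k (≤-reflexive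
    (solve 1 (λ k → con 2 :+ k :* con 3 := con 2 :* k :+ (con 1 :+ k) :+ con 1) refl k)))

mainTheorem4 : ∀ {n} (G : Graph n) (α : ℕ) →
    Connected G → OneWellCovered G → 2 < n → IsIndependenceNumber G α →
    (∀ k → 1 ≤ k → k < α → 2 * (α ∸ k) * s G k ≤ (k + 1) * s G (k + 1))
    × (∀ k → k < (2 * α + 2) / 3 → s G k ≤ s G (suc k))
    × (∀ k → 1 ≤ k → k < α → (k + 1) * s G (k + 1) < (n ∸ 2 * k) * s G k)
    × (∀ k → (n + 1) / 3 ≤ k → k < α → s G (suc k) < s G k)
mainTheorem4 {suc m} G α connected (wellCovered , _ , wellCovered-del) 2<n isα =
  (λ k _ k<α → subst (λ c → 2 * (α ∸ k) * s G k ≤ c * s G c) (+-comm 1 k) (s-growth k (<⇒≤ k<α))) ,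
  (λ k k<⌈2α/3⌉ →
    let (k≤α , 1+k≤2[α∸k]) = k<[2α+2]/3⇒k≤α×k<2[α∸k] k<⌈2α/3⌉
    in *-cancelˡ-≤ (suc k) (≤-trans (*-monoˡ-≤ (s G k) 1+k≤2[α∸k]) (s-growth k k≤α))) ,
  (λ k 1≤k k<α → subst (λ c → c * s G c < (suc m ∸ 2 * k) * s G k) (+-comm 1 k) (s-decay k 1≤k k<α)) ,
  (λ k ⌈n-1/3⌉≤k k<α →
    let (0<k , n∸2k≤1+k) = [n+1]/3≤k⇒0<k×n∸2k≤1+k 2<n ⌈n-1/3⌉≤k
    in *-cancelˡ-< (suc k) (s G (suc k)) (s G k) (<-≤-trans (s-decay k 0<k k<α) (*-monoˡ-≤ (s G k) n∸2k≤1+k)))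
  where open ConnectedOneWellCovered G connected 2<n wellCovered wellCovered-del isα
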